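{- Let $n\ge1$, $p\ge n$ and $k\ge0$ be integers, let $w\in[n]^\infty$, and let $X\subset[n]^\infty$ be a family of more than $\mathrm{Sun}(p,2k)$ distinct words, each at Hamming distance exactly $k$ from $w$. Then $X$ contains $p$ distinct words $a^1,\dots,a^p$ forming a $p$-sunflower with respect to $w$.
   Context: $[n]=\{1,\dots,n\}$, $[n]^\infty$ is the set of infinite sequences over $[n]$, and $\mathrm{dist}(a,b)=|\{i:a_i\ne b_i\}|$ is the Hamming distance. A $p$-sunflower is a family of $p$ distinct sets whose pairwise intersections are all identical. For integers $p\ge1$, $k\ge0$, $\mathrm{Sun}(p,k)$ denotes the least integer $N$ such that every family of more than $N$ distinct $k$-element sets contains a $p$-sunflower (it exists by the Erdős–Rado sunflower lemma). Words $a^1,\dots,a^p\in[n]^\infty$ form a $p$-sunflower with respect to $w$ if for each position $i$, either $a^1_i=\dots=a^p_i$, or there is a unique $j$ with $a^j_i\ne w_i$. -}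

module Defs where

open import Data.Nat using (ℕ; _<_; _≤_; _*_)
open import Data.Fin using (Fin)
open import Data.List using (List; length)
open import Data.List.Membership.Propositional using (_∈_)
open import Data.List.Relation.Unary.All using (All)
open import Data.List.Relation.Unary.AllPairs using (AllPairs)
open import Data.List.Relation.Unary.Unique.Propositional using (Unique)
open import Data.Product using (Σ; _×_)
open import Data.Sum using (_⊎_)
open import Function.Bundles using (_⇔_)
open import Relation.Binary.PropositionalEquality using (_≡_; _≢_)
open import Relation.Nullary using (¬_)

FinSet : Set
FinSet = List ℕ

_≈ₛ_ : FinSet → FinSet → Set
A ≈ₛ B = ∀ x → (x ∈ A) ⇔ (x ∈ B)

IsKSet : ℕ → FinSet → Set
IsKSet k A = Unique A × length A ≡ k

DistinctSets : List FinSet → Set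
DistinctSets F = AllPairs (λ A B → ¬ (A ≈ₛ B)) F

HasSunflower : ℕ → List FinSet → Set
HasSunflower p F =
  Σ (Fin p → FinSet) λ S →
    (∀ i → S i ∈ F) ×
    (∀ i j → i ≢ j → ¬ (S i ≈ₛ S j)) ×
    (∀ i j i' j' → i ≢ j → i' ≢ j' →
       ∀ x → ((x ∈ S i) × (x ∈ S j)) ⇔ ((x ∈ S i') × (x ∈ S j')))

SunBound : ℕ → ℕ → ℕ → Set
SunBound p k N =
  (F : List FinSet) → All (IsKSet k) F → DistinctSets F →
  N < length F → HasSunflower p F

IsSun : ℕ → ℕ → ℕ → Set
IsSun p k N = SunBound p k N × (∀ M → SunBound p k M → N ≤ M)

Word : ℕ → Set
Word n = ℕ → Fin n

_≗w_ : ∀ {n} → Word n → Word n → Set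
a ≗w b = ∀ i → a i ≡ b i

HammingDist : ∀ {n} → Word n → Word n → ℕ → Set
HammingDist a b k =
  Σ (List ℕ) λ D → Unique D × length D ≡ k × (∀ i → (i ∈ D) ⇔ (a i ≢ b i))

DistinctWords : ∀ {n} → List (Word n) → Set
DistinctWords X = AllPairs (λ a b → ¬ (a ≗w b)) X

IsWordSunflower : ∀ {n p} → Word n → (Fin p → Word n) → Set
IsWordSunflower {n} {p} w a =
  ∀ i → (∀ j j' → a j i ≡ a j' i) ⊎
        (Σ (Fin p) λ j → (a j i ≢ w i) × (∀ j' → a j' i ≢ w i → j' ≡ j))

{-# OPTIONS --safe #-}
module Submission where

-- Encode a word a at distance k from w as the 2k-set of its marks: for every
-- position i with aᵢ ≠ wᵢ, the position mark of i and the letter mark of (i, aᵢ).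
-- Distinct words give distinct mark sets, so more than Sun(p,2k) words yield a
-- p-sunflower of mark sets, with common core C. If two of the words differ from w
-- at i, the position mark of i lies in C, so all p words differ from w at i. As
-- only n - 1 < p letters differ from wᵢ, two of them carry the same letter there;
-- its letter mark then lies in C, so all p words carry it.

open import Defs
open import Data.Nat using (ℕ; suc; _+_; _*_; _≤_; _<_)
open import Data.Nat.DivMod using (_%_; [m+kn]%n≡m%n; m<n⇒m%n≡m)
open import Data.Nat.Properties using (+-cancelˡ-≡; *-cancelʳ-≡; +-identityʳ)
open import Data.Fin using (Fin; zero; suc; toℕ; punchOut; _≟_)
open import Data.Fin.Properties using (toℕ<n; toℕ-injective; any?; pigeonhole; punchOut-injective; <⇒≢)
open import Data.List using (List; []; _∷_; length; map; _++_)
open import Data.List.Membership.Propositional using (_∈_)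
open import Data.List.Membership.Propositional.Properties using (∈-map⁺; ∈-map⁻; ∈-++⁺ˡ; ∈-++⁺ʳ; ∈-++⁻)
open import Data.List.Properties using (length-++; length-map)
open import Data.List.Relation.Unary.All as All using (All; []; _∷_)
open import Data.List.Relation.Unary.AllPairs using (AllPairs; []; _∷_)
open import Data.List.Relation.Unary.Any using (here; there)
open import Data.List.Relation.Unary.Unique.Propositional using (Unique)
open import Data.List.Relation.Unary.Unique.Propositional.Properties using (map⁺; ++⁺)
open import Data.Product using (Σ; ∃; ∃₂; _×_; _,_; proj₁; proj₂)
open import Data.Sum using (_⊎_; inj₁; inj₂)
open import Function using (_∘_)
open import Function.Bundles using (_⇔_; mk⇔; Equivalence)
open import Relation.Binary.PropositionalEquality using (_≡_; _≢_; refl; sym; trans; cong; cong₂; subst; module ≡-Reasoning)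
open import Relation.Nullary using (¬_; yes; no; ¬?; _×-dec_)
open import Relation.Nullary.Decidable using (decidable-stable)
open import Relation.Nullary.Negation using (contraposition)
open import Relation.Unary using (Decidable)

open Equivalence using (to; from)

SameIntersections : ∀ {A : Set} {p} → (Fin p → List A) → Set
SameIntersections S =
  ∀ i j i' j' → i ≢ j → i' ≢ j' →
    ∀ x → ((x ∈ S i) × (x ∈ S j)) ⇔ ((x ∈ S i') × (x ∈ S j'))

∈-two⇒∈-all : ∀ {A : Set} {p} {S : Fin p → List A} → SameIntersections S →
              ∀ {j j' x} → j ≢ j' → x ∈ S j → x ∈ S j' → ∀ l → x ∈ S l
∈-two⇒∈-all core {j} j≢j' x∈Sj x∈Sj' l with l ≟ j
... | yes refl = x∈Sj
... | no l≢j   = proj₁ (from (core l j j _ l≢j j≢j' _) (x∈Sj , x∈Sj'))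

none⊎unique⊎two : ∀ {p} {P : Fin p → Set} → Decidable P →
  (∀ j → ¬ P j) ⊎
  (∃ λ j → P j × ∀ j' → P j' → j' ≡ j) ⊎
  (∃₂ λ j j' → j ≢ j' × P j × P j')
none⊎unique⊎two P? with any? P?
... | no ∄j = inj₁ λ j Pj → ∄j (j , Pj)
... | yes (j , Pj) with any? (λ j' → ¬? (j' ≟ j) ×-dec P? j')
...   | yes (j' , j'≢j , Pj') = inj₂ (inj₂ (j , j' , j'≢j ∘ sym , Pj , Pj'))
...   | no ∄j' = inj₂ (inj₁ (j , Pj , λ j' Pj' →
                   decidable-stable (j' ≟ j) λ j'≢j → ∄j' (j' , j'≢j , Pj')))

pigeonhole-avoiding : ∀ {n p} → n ≤ p → (c : Fin n) (f : Fin p → Fin n) →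
                      (∀ l → f l ≢ c) → ∃₂ λ l l' → l ≢ l' × f l ≡ f l'
pigeonhole-avoiding {suc _} n≤p c f f≢c
  with pigeonhole n≤p (λ l → punchOut (f≢c l ∘ sym))
... | l , l' , l<l' , same =
  l , l' , <⇒≢ l<l' , punchOut-injective (f≢c l ∘ sym) (f≢c l' ∘ sym) same

module _ {A B : Set} {R : A → B → Set} where

  chosen : ∀ {xs} → All (λ x → ∃ (R x)) xs → List B
  chosen []             = []
  chosen ((y , _) ∷ rs) = y ∷ chosen rs

  length-chosen : ∀ {xs} (rs : All (λ x → ∃ (R x)) xs) → length (chosen rs) ≡ length xs
  length-chosen []       = refl
  length-chosen (_ ∷ rs) = cong suc (length-chosen rs)

  ∈-chosen⁻ : ∀ {xs y} (rs : All (λ x → ∃ (R x)) xs) → y ∈ chosen rs →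
              ∃ λ x → x ∈ xs × R x y
  ∈-chosen⁻ ((_ , r) ∷ rs) (here refl) = _ , here refl , r
  ∈-chosen⁻ (_ ∷ rs) (there y∈) with ∈-chosen⁻ rs y∈
  ... | x , x∈xs , r = x , there x∈xs , r

  All-chosen : ∀ {P : A → Set} {Q : B → Set} → (∀ {x y} → P x → R x y → Q y) →
               ∀ {xs} → All P xs → (rs : All (λ x → ∃ (R x)) xs) → All Q (chosen rs)
  All-chosen f []         []             = []
  All-chosen f (px ∷ pxs) ((_ , r) ∷ rs) = f px r ∷ All-chosen f pxs rs

  AllPairs-chosen : ∀ {P : A → A → Set} {Q : B → B → Set} →
    (∀ {x x' y y'} → R x y → P x x' → R x' y' → Q y y') →
    ∀ {xs} → AllPairs P xs → (rs : All (λ x → ∃ (R x)) xs) → AllPairs Q (chosen rs)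
  AllPairs-chosen f []           []             = []
  AllPairs-chosen f (px ∷ pxs) ((_ , r) ∷ rs) =
    All-chosen (f r) px rs ∷ AllPairs-chosen f pxs rs

module MarkCode (n : ℕ) where

  code : ℕ → Fin (suc n) → ℕ
  code i v = toℕ v + i * suc n

  code-injective : ∀ i v i' v' → code i v ≡ code i' v' → i ≡ i' × v ≡ v'
  code-injective i v i' v' eq = i≡i' , v≡v'
    where
    remainder : ∀ i v → code i v % suc n ≡ toℕ v
    remainder i v = trans ([m+kn]%n≡m%n (toℕ v) i (suc n)) (m<n⇒m%n≡m (toℕ<n v))
    v≡v' : v ≡ v'
    v≡v' = toℕ-injective (trans (sym (remainder i v)) (trans (cong (_% suc n) eq) (remainder i' v')))
    i≡i' : i ≡ i'
    i≡i' = *-cancelʳ-≡ i i' (suc n)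
             (+-cancelˡ-≡ (toℕ v) _ _ (trans eq (cong (code i') (sym v≡v'))))

  positionMark : ℕ → ℕ
  positionMark i = code i zero

  letterMark : ℕ → Fin n → ℕ
  letterMark i v = code i (suc v)

module _ {n : ℕ} (w : Word n) where

  open MarkCode n

  data Marks (a : Word n) : ℕ → Set where
    position : ∀ {i} → a i ≢ w i → Marks a (positionMark i)
    letter   : ∀ {i} → a i ≢ w i → Marks a (letterMark i (a i))

  position⁻ : ∀ {a i} → Marks a (positionMark i) → a i ≢ w i
  position⁻ {a} {i} m = invert m refl
    where
    invert : ∀ {x} → Marks a x → x ≡ positionMark i → a i ≢ w i
    invert (position {j} a≢w) eq with code-injective j zero i zero eq
    ... | refl , _ = a≢w
    invert (letter {j} _) eq with () ← proj₂ (code-injective j (suc (a j)) i zero eq)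

  letter⁻ : ∀ {a i v} → Marks a (letterMark i v) → a i ≡ v
  letter⁻ {a} {i} {v} m = invert m refl
    where
    invert : ∀ {x} → Marks a x → x ≡ letterMark i v → a i ≡ v
    invert (position {j} _) eq with () ← proj₂ (code-injective j zero i (suc v) eq)
    invert (letter {j} _) eq with code-injective j (suc (a j)) i (suc v) eq
    ... | refl , refl = refl

  Marks-resp : ∀ {a b x} → a ≗w b → Marks a x → Marks b x
  Marks-resp a≗b (position a≢w) = position (a≢w ∘ trans (a≗b _))
  Marks-resp {b = b} a≗b (letter {i} a≢w) =
    subst (Marks b) (cong (letterMark i) (sym (a≗b i))) (letter (a≢w ∘ trans (a≗b i)))

  marks-⊆⇒agree : ∀ {a b i} → (∀ {x} → Marks a x → Marks b x) → a i ≢ w i → a i ≡ b i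
  marks-⊆⇒agree a⊆b a≢w = sym (letter⁻ (a⊆b (letter a≢w)))

  same-marks⇒≗w : ∀ {a b} → (∀ {x} → Marks a x → Marks b x) → (∀ {x} → Marks b x → Marks a x) →
                  a ≗w b
  same-marks⇒≗w {a} {b} a⊆b b⊆a i with a i ≟ w i | b i ≟ w i
  ... | no a≢w   | _        = marks-⊆⇒agree a⊆b a≢w
  ... | _        | no b≢w   = sym (marks-⊆⇒agree b⊆a b≢w)
  ... | yes a≡w  | yes b≡w  = trans a≡w (sym b≡w)

  Represents : FinSet → Word n → Set
  Represents A a = ∀ x → (x ∈ A) ⇔ Marks a x

  ≈ₛ⇒≗w : ∀ {A B a b} → Represents A a → Represents B b → A ≈ₛ B → a ≗w b
  ≈ₛ⇒≗w rA rB A≈B = same-marks⇒≗w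
    (λ {x} → to (rB x) ∘ to (A≈B x) ∘ from (rA x))
    (λ {x} → to (rA x) ∘ from (A≈B x) ∘ from (rB x))

  ≗w⇒≈ₛ : ∀ {A B a b} → Represents A a → Represents B b → a ≗w b → A ≈ₛ B
  ≗w⇒≈ₛ rA rB a≗b x = mk⇔
    (from (rB x) ∘ Marks-resp a≗b ∘ to (rA x))
    (from (rA x) ∘ Marks-resp (sym ∘ a≗b) ∘ to (rB x))

  markList : Word n → List ℕ → List ℕ
  markList a D = map positionMark D ++ map (λ i → letterMark i (a i)) D

  markList-represents : ∀ {a D} → (∀ i → (i ∈ D) ⇔ (a i ≢ w i)) → Represents (markList a D) a
  markList-represents {a} {D} differ x = mk⇔ marked listed
    where
    marked : x ∈ markList a D → Marks a x
    marked x∈ with ∈-++⁻ (map positionMark D) x∈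
    ... | inj₁ x∈pos with ∈-map⁻ positionMark x∈pos
    ...   | i , i∈D , refl = position (to (differ i) i∈D)
    marked x∈ | inj₂ x∈let with ∈-map⁻ (λ i → letterMark i (a i)) x∈let
    ...   | i , i∈D , refl = letter (to (differ i) i∈D)
    listed : Marks a x → x ∈ markList a D
    listed (position a≢w) = ∈-++⁺ˡ (∈-map⁺ positionMark (from (differ _) a≢w))
    listed (letter a≢w)   =
      ∈-++⁺ʳ (map positionMark D) (∈-map⁺ (λ i → letterMark i (a i)) (from (differ _) a≢w))

  markList-isKSet : ∀ {a D} → Unique D → IsKSet (2 * length D) (markList a D)
  markList-isKSet {a} {D} D-unique =
    ++⁺ (map⁺ (λ {i j} → proj₁ ∘ code-injective i zero j zero) D-unique)
        (map⁺ (λ {i j} → proj₁ ∘ code-injective i (suc (a i)) j (suc (a j))) D-unique)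
        (λ (x∈pos , x∈let) → disjoint (∈-map⁻ positionMark x∈pos) (∈-map⁻ _ x∈let)) ,
    length-markList
    where
    open ≡-Reasoning
    disjoint : ∀ {x} → (∃ λ i → i ∈ D × x ≡ positionMark i) →
               ¬ (∃ λ j → j ∈ D × x ≡ letterMark j (a j))
    disjoint (i , _ , refl) (j , _ , eq) with () ← proj₂ (code-injective i zero j (suc (a j)) eq)
    length-markList : length (markList a D) ≡ 2 * length D
    length-markList = begin
      length (markList a D)
        ≡⟨ length-++ (map positionMark D) ⟩
      length (map positionMark D) + length (map (λ i → letterMark i (a i)) D)
        ≡⟨ cong₂ _+_ (length-map _ D) (length-map _ D) ⟩
      length D + length D
        ≡⟨ cong (length D +_) (sym (+-identityʳ (length D))) ⟩
      2 * length D ∎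

  module _ {p} (n≤p : n ≤ p) {S : Fin p → FinSet} {a : Fin p → Word n}
           (represents : ∀ j → Represents (S j) (a j)) (core : SameIntersections S) where

    shared-mark⇒common : ∀ {j j' x} → j ≢ j' → Marks (a j) x → Marks (a j') x →
                         ∀ l → Marks (a l) x
    shared-mark⇒common {j} {j'} {x} j≢j' m m' l =
      to (represents l x) (∈-two⇒∈-all core j≢j' (from (represents j x) m) (from (represents j' x) m') l)

    two-differ⇒all-differ : ∀ {j j' i} → j ≢ j' → a j i ≢ w i → a j' i ≢ w i →
                            ∀ l → a l i ≢ w i
    two-differ⇒all-differ j≢j' a≢w a'≢w l =
      position⁻ (shared-mark⇒common j≢j' (position a≢w) (position a'≢w) l)

    all-differ⇒all-agree : ∀ {i} → (∀ l → a l i ≢ w i) → ∀ j j' → a j i ≡ a j' i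
    all-differ⇒all-agree {i} all-differ
      with pigeonhole-avoiding n≤p (w i) (λ l → a l i) all-differ
    ... | l , l' , l≢l' , same = λ j j' → trans (agree j) (sym (agree j'))
      where
      agree : ∀ j → a j i ≡ a l i
      agree = letter⁻ ∘ shared-mark⇒common l≢l' (letter (all-differ l))
                (subst (Marks (a l') ∘ letterMark i) (sym same) (letter (all-differ l')))

    isWordSunflower : IsWordSunflower w a
    isWordSunflower i with none⊎unique⊎two (λ j → ¬? (a j i ≟ w i))
    ... | inj₁ none-differ =
      inj₁ λ j j' → trans (agree-with-w j) (sym (agree-with-w j'))
      where
      agree-with-w : ∀ j → a j i ≡ w i
      agree-with-w j = decidable-stable (a j i ≟ w i) (none-differ j)
    ... | inj₂ (inj₁ one-differs) = inj₂ one-differs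
    ... | inj₂ (inj₂ (j , j' , j≢j' , a≢w , a'≢w)) =
      inj₁ (all-differ⇒all-agree (two-differ⇒all-differ j≢j' a≢w a'≢w))

  HasWordSunflower : ℕ → List (Word n) → Set
  HasWordSunflower p X =
    Σ (Fin p → Word n) λ a →
      (∀ j → a j ∈ X) ×
      (∀ j j' → j ≢ j' → ¬ (a j ≗w a j')) ×
      IsWordSunflower w a

  module _ (k : ℕ) where

    MarkSet : Word n → FinSet → Set
    MarkSet a A = Represents A a × IsKSet (2 * k) A

    markSet : ∀ {a} → HammingDist a w k → ∃ (MarkSet a)
    markSet {a} (D , D-unique , refl , differ) =
      markList a D , markList-represents differ , markList-isKSet D-unique

    markSets-distinct : ∀ {X} → DistinctWords X → (sets : All (λ a → ∃ (MarkSet a)) X) →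
                        DistinctSets (chosen sets)
    markSets-distinct = AllPairs-chosen λ (rA , _) a≠b (rB , _) → contraposition (≈ₛ⇒≗w rA rB) a≠b

    markSunflower⇒wordSunflower : ∀ {p X} → n ≤ p → (sets : All (λ a → ∃ (MarkSet a)) X) →
                                  HasSunflower p (chosen sets) → HasWordSunflower p X
    markSunflower⇒wordSunflower {p} {X} n≤p sets (S , S∈ , S-distinct , core) =
      a , (proj₁ ∘ proj₂ ∘ source) ,
      (λ j j' j≢j' → S-distinct j j' j≢j' ∘ ≗w⇒≈ₛ (represents j) (represents j')) ,
      isWordSunflower n≤p represents core
      where
      source : ∀ j → ∃ λ b → b ∈ X × MarkSet b (S j)
      source j = ∈-chosen⁻ sets (S∈ j)
      a : Fin p → Word n
      a = proj₁ ∘ source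
      represents : ∀ j → Represents (S j) (a j)
      represents = proj₁ ∘ proj₂ ∘ proj₂ ∘ source

lemma11 : (n p k : ℕ) → 1 ≤ n → n ≤ p →
          (w : Word n) (X : List (Word n)) → DistinctWords X →
          All (λ a → HammingDist a w k) X →
          (N : ℕ) → IsSun p (2 * k) N → N < length X →
          Σ (Fin p → Word n) λ a →
            (∀ j → a j ∈ X) ×
            (∀ j j' → j ≢ j' → ¬ (a j ≗w a j')) ×
            IsWordSunflower w a
lemma11 n p k _ n≤p w X X-distinct X-dist N (sunBound , _) N<|X| =
  markSunflower⇒wordSunflower w k n≤p sets
    (sunBound (chosen sets) (All-chosen (λ _ → proj₂) X-dist sets)
      (markSets-distinct w k X-distinct sets)
      (subst (N <_) (sym (length-chosen sets)) N<|X|))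
  where
  sets : All (λ a → ∃ (MarkSet w k a)) X
  sets = All.map (markSet w k) X-dist
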